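{- Let $\Omega$ be a set, $q$ a set of operations on $\Omega$, $\sim$ the relation $\sim_q$, and $\pi\in\mathrm{Sim}(q)$. Then: (1) $\pi/\sim$ is a permutation of $\Omega/\sim$; (2) if $R$ is invariant under $\sim$ then $R\,\pi\,S$, where $S=\pi(R)$; (3) if $\bar a,\bar b\in\Omega^\alpha$ ($\alpha$ an ordinal), $\bar a\,\pi\,\bar b$, and $\varphi(\bar x)$ is a formula of $\mathscr{L}^-_{\infty\infty}(q)$, then $\Omega,q\models\varphi(\bar a)\leftrightarrow\varphi(\bar b)$.
   Context: A set of operations $q$ on $\Omega$ is a set of first-order relations (subsets of $\Omega^k$, $k$ finite) and quantifiers on $\Omega$, where a quantifier of type $(k_1,\dots,k_l)$ is a subset of $\mathcal P(\Omega^{k_1})\times\dots\times\mathcal P(\Omega^{k_l})$. $\mathscr{L}^-_{\infty\infty}(q)$ is the equality-free infinitary logic (arbitrary conjunctions/disjunctions, quantification over arbitrarily long sequences of variables, no equality symbol) with a predicate symbol for each relation of $q$ and a generalized quantifier symbol for each $Q\in q$, where $Q\bar x_1\dots\bar x_l(\varphi_1,\dots,\varphi_l)$ holds iff $(\|\varphi_1\|,\dots,\|\varphi_l\|)\in Q$, $\|\varphi_i\|\subseteq\Omega^{k_i}$ the set of tuples satisfying $\varphi_i$ in the bound variables $\bar x_i$. $a\sim_q b$ iff for every formula $\varphi(x,\bar x)$ ($\bar x$ possibly infinite), $\Omega,q\models\forall\bar x(\varphi(a,\bar x)\leftrightarrow\varphi(b,\bar x))$. A similarity on $\Omega$ is $\pi\subseteq\Omega\times\Omega$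 such that every $a$ has some $b$ with $a\,\pi\,b$ and every $b$ has some $a$ with $a\,\pi\,b$; on tuples componentwise. For $R,S\subseteq\Omega^k$, $R\,\pi\,S$ means: for all $\bar a\,\pi\,\bar b$, $\bar a\in R$ iff $\bar b\in S$ (componentwise for tuples of relations); $\pi(R)=\{\bar b:\exists\bar a\in R,\ \bar a\,\pi\,\bar b\}$; $R$ is invariant under $\pi$ if $R\,\pi\,R$; $R$ is invariant under an equivalence $\sim$ if $\bar a\in R$, $\bar a\sim\bar b$ imply $\bar b\in R$. A quantifier $Q$ is $\sim$-invariant under $\pi$ if for all $\bar R,\bar S$ of its type with all components invariant under $\sim$ and $\bar R\,\pi\,\bar S$: $\bar R\in Q$ iff $\bar S\in Q$; a relation is $\sim$-invariant under $\pi$ iff invariant under $\pi$. $\mathrm{Sim}(q)$ is the set of similarities $\pi$ such that every member of $q$ is $\sim_q$-invariant under $\pi$. $\Omega/\sim$ is the set of equivalence classes $[a]$ and $\pi/\sim=\{([a],[b]): a\,\pi\,b\}$. -}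

module Defs where

open import Data.Nat using (ℕ)
open import Data.Fin using (Fin)
open import Data.Unit using (⊤; tt)
open import Data.Sum using (_⊎_; inj₁; inj₂; [_,_])
open import Data.Product using (Σ; _×_; _,_)
open import Relation.Nullary using (¬_)

_⟺_ : ∀ {a b} → Set a → Set b → Set _
A ⟺ B = (A → B) × (B → A)

-- A quantifier of type (k₁,…,kₗ) is a subset of P(Ω^k₁)×…×P(Ω^kₗ);
-- since subsets of sets are extensional, it must respect pointwise
-- equivalence of its arguments (field quant-ext).
record Ops (Ω : Set) : Set₁ where
  field
    RelSym    : Set
    arity     : RelSym → ℕ
    rel       : (r : RelSym) → (Fin (arity r) → Ω) → Set
    QSym      : Set
    qlen      : QSym → ℕ
    qtype     : (Q : QSym) → Fin (qlen Q) → ℕ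
    quant     : (Q : QSym) → ((i : Fin (qlen Q)) → (Fin (qtype Q i) → Ω) → Set) → Set
    quant-ext : (Q : QSym) (R S : (i : Fin (qlen Q)) → (Fin (qtype Q i) → Ω) → Set) →
                (∀ i t → R i t ⟺ S i t) → quant Q R → quant Q S

module _ {Ω : Set} (q : Ops Ω) where
  open Ops q

  -- Formulas of the equality-free infinitary logic L⁻_{∞∞}(q) whose free
  -- variables are indexed by the type V.
  data Formula : Set → Set₁ where
    atom : ∀ {V} (r : RelSym) → (Fin (arity r) → V) → Formula V
    neg  : ∀ {V} → Formula V → Formula V
    conj : ∀ {V} (I : Set) → (I → Formula V) → Formula V
    disj : ∀ {V} (I : Set) → (I → Formula V) → Formula V
    ex   : ∀ {V} (W : Set) → Formula (V ⊎ W) → Formula V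
    all  : ∀ {V} (W : Set) → Formula (V ⊎ W) → Formula V
    gq   : ∀ {V} (Q : QSym) → ((i : Fin (qlen Q)) → Formula (V ⊎ Fin (qtype Q i))) → Formula V

  ⟦_⟧ : ∀ {V} → Formula V → (V → Ω) → Set
  ⟦ atom r f ⟧ ρ = rel r (λ i → ρ (f i))
  ⟦ neg φ ⟧ ρ = ¬ ⟦ φ ⟧ ρ
  ⟦ conj I φs ⟧ ρ = (i : I) → ⟦ φs i ⟧ ρ
  ⟦ disj I φs ⟧ ρ = Σ I (λ i → ⟦ φs i ⟧ ρ)
  ⟦ ex W φ ⟧ ρ = Σ (W → Ω) (λ σ → ⟦ φ ⟧ [ ρ , σ ])
  ⟦ all W φ ⟧ ρ = (σ : W → Ω) → ⟦ φ ⟧ [ ρ , σ ]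
  ⟦ gq Q φs ⟧ ρ = quant Q (λ i t → ⟦ φs i ⟧ [ ρ , t ])

  _∼_ : Ω → Ω → Set₁
  a ∼ b = (W : Set) (φ : Formula (⊤ ⊎ W)) (σ : W → Ω) →
          ⟦ φ ⟧ [ (λ _ → a) , σ ] ⟺ ⟦ φ ⟧ [ (λ _ → b) , σ ]

Pointwise : ∀ {ℓ} {Ω A : Set} → (Ω → Ω → Set ℓ) → (A → Ω) → (A → Ω) → Set ℓ
Pointwise π a b = ∀ i → π (a i) (b i)

IsSimilarity : {Ω : Set} → (Ω → Ω → Set) → Set
IsSimilarity {Ω} π = ((a : Ω) → Σ Ω (λ b → π a b)) × ((b : Ω) → Σ Ω (λ a → π a b))

RelSim : {Ω : Set} {k : ℕ} → (Ω → Ω → Set) → ((Fin k → Ω) → Set) → ((Fin k → Ω) → Set) → Set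
RelSim π R S = ∀ a b → Pointwise π a b → R a ⟺ S b

image : {Ω : Set} {k : ℕ} → (Ω → Ω → Set) → ((Fin k → Ω) → Set) → (Fin k → Ω) → Set
image {Ω} {k} π R b = Σ (Fin k → Ω) (λ a → R a × Pointwise π a b)

InvariantUnder : ∀ {ℓ} {Ω : Set} {k : ℕ} → (Ω → Ω → Set ℓ) → ((Fin k → Ω) → Set) → Set ℓ
InvariantUnder {Ω = Ω} {k} E R = (a b : Fin k → Ω) → R a → Pointwise E a b → R b

module _ {Ω : Set} (q : Ops Ω) where
  open Ops q

  InSim : (Ω → Ω → Set) → Set₁
  InSim π = IsSimilarity π
    × ((r : RelSym) → RelSim π (rel r) (rel r))
    × ((Q : QSym) (R S : (i : Fin (qlen Q)) → (Fin (qtype Q i) → Ω) → Set) →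
        (∀ i → InvariantUnder (_∼_ q) (R i)) →
        (∀ i → InvariantUnder (_∼_ q) (S i)) →
        (∀ i → RelSim π (R i) (S i)) →
        quant Q R ⟺ quant Q S)

  -- π/∼ = { ([a],[b]) : a π b }, as a relation between representatives
  QuotRel : (Ω → Ω → Set) → Ω → Ω → Set₁
  QuotRel π a b = Σ Ω (λ a' → Σ Ω (λ b' → _∼_ q a a' × _∼_ q b b' × π a' b'))

  IsPermutationOfQuotient : (Ω → Ω → Set) → Set₁
  IsPermutationOfQuotient π =
      ((a : Ω) → Σ Ω (λ b → QuotRel π a b))
    × ((a b b' : Ω) → QuotRel π a b → QuotRel π a b' → _∼_ q b b')
    × ((b : Ω) → Σ Ω (λ a → QuotRel π a b))
    × ((a a' b : Ω) → QuotRel π a b → QuotRel π a' b → _∼_ q a a')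

-- Every formula is preserved along a similarity π ∈ Sim(q), by induction on
-- formulas: relations are π-invariant, ∃/∀ transfer witnesses using that π is
-- total in both directions, and at a generalized quantifier the argument
-- relations are ∼-invariant (one variable at a time, by the definition of ∼),
-- so the invariance condition on Q applies.  Since ∼ is defined by formulas,
-- π then maps ∼-classes to ∼-classes; the same holds for the converse of π,
-- which is again in Sim(q), so π/∼ is a permutation of Ω/∼, and a
-- ∼-invariant R is recovered from π(R).
module Submission where

open import Defs
open import Data.Nat using (ℕ; zero; suc)
open import Data.Fin using (Fin; zero; suc)
open import Data.Product using (Σ; _×_; _,_; proj₁; proj₂; swap; map₂)
open import Data.Sum using (_⊎_; inj₁; inj₂; [_,_]; map₁; assocʳ)
open import Data.Unit using (⊤)
open import Function using (_∘_; id; flip; const)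
open import Relation.Nullary using (¬_)
open import Relation.Binary.PropositionalEquality using (refl; sym; subst; _≗_)

⟺-sym : ∀ {a b} {A : Set a} {B : Set b} → A ⟺ B → B ⟺ A
⟺-sym = swap

⟺-trans : ∀ {a b c} {A : Set a} {B : Set b} {C : Set c} → A ⟺ B → B ⟺ C → A ⟺ C
⟺-trans (f , g) (h , k) = h ∘ f , g ∘ k

¬-⟺ : {A B : Set} → A ⟺ B → (¬ A) ⟺ (¬ B)
¬-⟺ (f , g) = (λ ¬a → ¬a ∘ g) , (λ ¬b → ¬b ∘ f)

Π-⟺ : {I : Set} {A B : I → Set} → (∀ i → A i ⟺ B i) → ((i : I) → A i) ⟺ ((i : I) → B i)
Π-⟺ A⟺B = (λ f i → proj₁ (A⟺B i) (f i)) , (λ g i → proj₂ (A⟺B i) (g i))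

Σ-⟺ : {I : Set} {A B : I → Set} → (∀ i → A i ⟺ B i) → Σ I A ⟺ Σ I B
Σ-⟺ A⟺B = map₂ (proj₁ (A⟺B _)) , map₂ (proj₂ (A⟺B _))

[,]-map₁-≗ : ∀ {V V' W Ω : Set} {f : V → V'} {ρ : V' → Ω} {ρ₀ : V → Ω} →
             ρ ∘ f ≗ ρ₀ → (σ : W → Ω) → [ ρ , σ ] ∘ map₁ f ≗ [ ρ₀ , σ ]
[,]-map₁-≗ H σ (inj₁ v) = H v
[,]-map₁-≗ H σ (inj₂ w) = refl

module Semantics {Ω : Set} (q : Ops Ω) where
  open Ops q

  rename : ∀ {V V'} → (V → V') → Formula q V → Formula q V'
  rename f (atom r g)  = atom r (f ∘ g)
  rename f (neg φ)     = neg (rename f φ)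
  rename f (conj I φs) = conj I (rename f ∘ φs)
  rename f (disj I φs) = disj I (rename f ∘ φs)
  rename f (ex W φ)    = ex W (rename (map₁ f) φ)
  rename f (all W φ)   = all W (rename (map₁ f) φ)
  rename f (gq Q φs)   = gq Q (rename (map₁ f) ∘ φs)

  ∼-refl : ∀ {a} → _∼_ q a a
  ∼-refl W φ σ = id , id

  ∼-sym : ∀ {a b} → _∼_ q a b → _∼_ q b a
  ∼-sym a∼b W φ σ = ⟺-sym (a∼b W φ σ)

  ∼-trans : ∀ {a b c} → _∼_ q a b → _∼_ q b c → _∼_ q a c
  ∼-trans a∼b b∼c W φ σ = ⟺-trans (a∼b W φ σ) (b∼c W φ σ)

  module _ (rel-resp-≗ : ∀ r {u v} → u ≗ v → rel r u → rel r v) where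

    ⟦⟧-rename : ∀ {V V'} (f : V → V') (φ : Formula q V) {ρ : V' → Ω} {ρ₀ : V → Ω} →
                ρ ∘ f ≗ ρ₀ → ⟦_⟧ q (rename f φ) ρ ⟺ ⟦_⟧ q φ ρ₀
    ⟦⟧-rename f (atom r g)  H = rel-resp-≗ r (H ∘ g) , rel-resp-≗ r (sym ∘ H ∘ g)
    ⟦⟧-rename f (neg φ)     H = ¬-⟺ (⟦⟧-rename f φ H)
    ⟦⟧-rename f (conj I φs) H = Π-⟺ (λ i → ⟦⟧-rename f (φs i) H)
    ⟦⟧-rename f (disj I φs) H = Σ-⟺ (λ i → ⟦⟧-rename f (φs i) H)
    ⟦⟧-rename f (ex W φ)    H = Σ-⟺ (λ σ → ⟦⟧-rename (map₁ f) φ ([,]-map₁-≗ H σ))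
    ⟦⟧-rename f (all W φ)   H = Π-⟺ (λ σ → ⟦⟧-rename (map₁ f) φ ([,]-map₁-≗ H σ))
    ⟦⟧-rename f (gq Q φs)   H =
        quant-ext Q _ _ (λ i t → ⟦⟧-rename (map₁ f) (φs i) ([,]-map₁-≗ H t))
      , quant-ext Q _ _ (λ i t → ⟺-sym (⟦⟧-rename (map₁ f) (φs i) ([,]-map₁-≗ H t)))

    ⟦⟧-resp-≗ : ∀ {V} (φ : Formula q V) {ρ ρ' : V → Ω} → ρ ≗ ρ' → ⟦_⟧ q φ ρ → ⟦_⟧ q φ ρ'
    ⟦⟧-resp-≗ φ ρ≗ρ' = proj₁ (⟦⟧-rename id φ (λ _ → refl)) ∘ proj₂ (⟦⟧-rename id φ (sym ∘ ρ≗ρ'))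

    ∼-head : ∀ {V W a b} → _∼_ q a b → (φ : Formula q ((⊤ ⊎ V) ⊎ W)) (ρ : V → Ω) (σ : W → Ω) →
             ⟦_⟧ q φ [ [ const a , ρ ] , σ ] → ⟦_⟧ q φ [ [ const b , ρ ] , σ ]
    ∼-head {V} {W} a∼b φ ρ σ =
      proj₁ (⟦⟧-rename assocʳ φ (reassoc _)) ∘
      proj₁ (a∼b (V ⊎ W) (rename assocʳ φ) [ ρ , σ ]) ∘
      proj₂ (⟦⟧-rename assocʳ φ (reassoc _))
      where
        reassoc : ∀ x → [ const x , [ ρ , σ ] ] ∘ assocʳ ≗ [ [ const x , ρ ] , σ ]
        reassoc x (inj₁ (inj₁ _)) = refl
        reassoc x (inj₁ (inj₂ v)) = refl
        reassoc x (inj₂ w)        = refl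

    ⟦⟧-invariant-∼ : ∀ {V k} (ψ : Formula q (V ⊎ Fin k)) (ρ : V → Ω) →
                     InvariantUnder (_∼_ q) (λ t → ⟦_⟧ q ψ [ ρ , t ])
    ⟦⟧-invariant-∼ {k = zero} ψ ρ t t' ψt _ = ⟦⟧-resp-≗ ψ no-tuple ψt
      where
        no-tuple : [ ρ , t ] ≗ [ ρ , t' ]
        no-tuple (inj₁ v) = refl
        no-tuple (inj₂ ())
    ⟦⟧-invariant-∼ {V} {suc k} ψ ρ t t' ψt t∼t' =
      from t' (∼-head (t∼t' zero) ψ' ρ (t' ∘ suc)
        (⟦⟧-invariant-∼ ψ' [ const (t zero) , ρ ] (t ∘ suc) (t' ∘ suc) (to t ψt) (t∼t' ∘ suc)))
      where
        split-first : V ⊎ Fin (suc k) → (⊤ ⊎ V) ⊎ Fin k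
        split-first (inj₁ v)       = inj₁ (inj₂ v)
        split-first (inj₂ zero)    = inj₁ (inj₁ _)
        split-first (inj₂ (suc j)) = inj₂ j

        ψ' : Formula q ((⊤ ⊎ V) ⊎ Fin k)
        ψ' = rename split-first ψ

        split-first-≗ : ∀ s → [ [ const (s zero) , ρ ] , s ∘ suc ] ∘ split-first ≗ [ ρ , s ]
        split-first-≗ s (inj₁ v)       = refl
        split-first-≗ s (inj₂ zero)    = refl
        split-first-≗ s (inj₂ (suc j)) = refl

        to : ∀ s → ⟦_⟧ q ψ [ ρ , s ] → ⟦_⟧ q ψ' [ [ const (s zero) , ρ ] , s ∘ suc ]
        to s = proj₂ (⟦⟧-rename split-first ψ (split-first-≗ s))

        from : ∀ s → ⟦_⟧ q ψ' [ [ const (s zero) , ρ ] , s ∘ suc ] → ⟦_⟧ q ψ [ ρ , s ]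
        from s = proj₁ (⟦⟧-rename split-first ψ (split-first-≗ s))

InSim-flip : ∀ {Ω} {q : Ops Ω} {π : Ω → Ω → Set} → InSim q π → InSim q (flip π)
InSim-flip ((forth , back) , rel-sim , quant-sim) =
    (back , forth)
  , (λ r a b p → ⟺-sym (rel-sim r b a p))
  , (λ Q R S R-inv S-inv R∼S → ⟺-sym (quant-sim Q S R S-inv R-inv (λ i a b p → ⟺-sym (R∼S i b a p))))

module Similarity {Ω : Set} (q : Ops Ω) {π : Ω → Ω → Set} (sim : InSim q π) where
  open Ops q
  open Semantics q

  private
    forth : ∀ a → Σ Ω (π a)
    forth = proj₁ (proj₁ sim)

    back : ∀ b → Σ Ω (flip π b)
    back = proj₂ (proj₁ sim)

    rel-sim : ∀ r → RelSim π (rel r) (rel r)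
    rel-sim = proj₁ (proj₂ sim)

    quant-sim : (Q : QSym) (R S : (i : Fin (qlen Q)) → (Fin (qtype Q i) → Ω) → Set) →
                (∀ i → InvariantUnder (_∼_ q) (R i)) → (∀ i → InvariantUnder (_∼_ q) (S i)) →
                (∀ i → RelSim π (R i) (S i)) → quant Q R ⟺ quant Q S
    quant-sim = proj₂ (proj₂ sim)

  -- Relations are not assumed to respect ≗; they do because both tuples are
  -- π-related to a common image and relations are π-invariant.
  rel-resp-≗ : ∀ r {u v} → u ≗ v → rel r u → rel r v
  rel-resp-≗ r {u} {v} u≗v =
    proj₂ (rel-sim r v w (λ i → subst (λ x → π x (w i)) (u≗v i) (proj₂ (forth (u i))))) ∘
    proj₁ (rel-sim r u w (proj₂ ∘ forth ∘ u))
    where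
      w : Fin (arity r) → Ω
      w = proj₁ ∘ forth ∘ u

  Pointwise-[,] : ∀ {A W : Set} {a b : A → Ω} {σ τ : W → Ω} →
                  Pointwise π a b → Pointwise π σ τ → Pointwise π [ a , σ ] [ b , τ ]
  Pointwise-[,] pa pσ (inj₁ v) = pa v
  Pointwise-[,] pa pσ (inj₂ w) = pσ w

  ⟦⟧-preserved : ∀ {A} (φ : Formula q A) {a b : A → Ω} → Pointwise π a b → ⟦_⟧ q φ a ⟺ ⟦_⟧ q φ b
  ⟦⟧-preserved (atom r f)  p = rel-sim r _ _ (p ∘ f)
  ⟦⟧-preserved (neg φ)     p = ¬-⟺ (⟦⟧-preserved φ p)
  ⟦⟧-preserved (conj I φs) p = Π-⟺ (λ i → ⟦⟧-preserved (φs i) p)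
  ⟦⟧-preserved (disj I φs) p = Σ-⟺ (λ i → ⟦⟧-preserved (φs i) p)
  ⟦⟧-preserved (ex W φ)    p =
      (λ (σ , x) → proj₁ ∘ forth ∘ σ , proj₁ (⟦⟧-preserved φ (Pointwise-[,] p (proj₂ ∘ forth ∘ σ))) x)
    , (λ (τ , x) → proj₁ ∘ back ∘ τ , proj₂ (⟦⟧-preserved φ (Pointwise-[,] p (proj₂ ∘ back ∘ τ))) x)
  ⟦⟧-preserved (all W φ)   p =
      (λ h τ → proj₁ (⟦⟧-preserved φ (Pointwise-[,] p (proj₂ ∘ back ∘ τ))) (h _))
    , (λ h σ → proj₂ (⟦⟧-preserved φ (Pointwise-[,] p (proj₂ ∘ forth ∘ σ))) (h _))
  ⟦⟧-preserved (gq Q φs) {a} {b} p =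
    quant-sim Q _ _
      (λ i → ⟦⟧-invariant-∼ rel-resp-≗ (φs i) a)
      (λ i → ⟦⟧-invariant-∼ rel-resp-≗ (φs i) b)
      (λ i t t' pt → ⟦⟧-preserved (φs i) (Pointwise-[,] p pt))

  π-resp-∼ : ∀ {a₁ a₂ b₁ b₂} → _∼_ q a₁ a₂ → π a₁ b₁ → π a₂ b₂ → _∼_ q b₁ b₂
  π-resp-∼ a₁∼a₂ p₁ p₂ W φ σ =
    ⟺-trans (⟺-sym (⟦⟧-preserved φ (Pointwise-[,] (const p₁) τπσ)))
      (⟺-trans (a₁∼a₂ W φ τ) (⟦⟧-preserved φ (Pointwise-[,] (const p₂) τπσ)))
    where
      τ : W → Ω
      τ = proj₁ ∘ back ∘ σ

      τπσ : Pointwise π τ σ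
      τπσ = proj₂ ∘ back ∘ σ

  QuotRel-total : ∀ a → Σ Ω (QuotRel q π a)
  QuotRel-total a = let (b , p) = forth a in b , a , b , ∼-refl , ∼-refl , p

  QuotRel-functional : ∀ {a b b'} → QuotRel q π a b → QuotRel q π a b' → _∼_ q b b'
  QuotRel-functional (a₁ , b₁ , a∼a₁ , b∼b₁ , p₁) (a₂ , b₂ , a∼a₂ , b'∼b₂ , p₂) =
    ∼-trans b∼b₁ (∼-trans (π-resp-∼ (∼-trans (∼-sym a∼a₁) a∼a₂) p₁ p₂) (∼-sym b'∼b₂))

QuotRel-flip : ∀ {Ω} {q : Ops Ω} {π : Ω → Ω → Set} {a b} → QuotRel q π a b → QuotRel q (flip π) b a
QuotRel-flip (a' , b' , a∼a' , b∼b' , p) = b' , a' , b∼b' , a∼a' , p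

quotient-permutation : ∀ {Ω} {q : Ops Ω} {π : Ω → Ω → Set} → InSim q π → IsPermutationOfQuotient q π
quotient-permutation sim =
    S.QuotRel-total
  , (λ _ _ _ → S.QuotRel-functional)
  , (λ b → map₂ QuotRel-flip (S˘.QuotRel-total b))
  , (λ _ _ _ x y → S˘.QuotRel-functional (QuotRel-flip x) (QuotRel-flip y))
  where
    module S = Similarity _ sim
    module S˘ = Similarity _ (InSim-flip sim)

RelSim-image : ∀ {Ω} {q : Ops Ω} {π : Ω → Ω → Set} {k} {R : (Fin k → Ω) → Set} →
            InSim q π → InvariantUnder (_∼_ q) R → RelSim π R (image π R)
RelSim-image {q = q} sim R-inv a b p =
    (λ x → a , x , p)
  , (λ (a' , x , p') → R-inv a' a x (λ i → S˘.π-resp-∼ ∼-refl (p' i) (p i)))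
  where
    open Semantics q using (∼-refl)
    module S˘ = Similarity q (InSim-flip sim)

lemma14 : {Ω : Set} (q : Ops Ω) (π : Ω → Ω → Set) → InSim q π →
    IsPermutationOfQuotient q π
    × ((k : ℕ) (R : (Fin k → Ω) → Set) → InvariantUnder (_∼_ q) R → RelSim π R (image π R))
    × ((A : Set) (a b : A → Ω) → Pointwise π a b → (φ : Formula q A) → ⟦_⟧ q φ a ⟺ ⟦_⟧ q φ b)
lemma14 q π sim =
    quotient-permutation sim
  , (λ k R → RelSim-image sim)
  , (λ A a b p φ → Similarity.⟦⟧-preserved q sim φ p)
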